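{- Let $\{a,b,c,d,e\}$ be a Diophantine quintuple with $a<b<c<d<e$ such that $\{a,b,c\}$ is an Euler triple, i.e. $c=a+b+2r$ where $r=\sqrt{ab+1}$, and $d=4r(a+r)(b+r)$. Let $s,t,x,y,z,X,Y,Z,W$ be the positive integers with $ac+1=s^2$, $bc+1=t^2$, $ad+1=x^2$, $bd+1=y^2$, $cd+1=z^2$, $ae+1=X^2$, $be+1=Y^2$, $ce+1=Z^2$, $de+1=W^2$. Suppose $\varepsilon\in\{1,-1\}$ and nonnegative integers $j,k,l,m,n$ satisfy $Z\sqrt a+X\sqrt c=(\sqrt a+\sqrt c)(s+\sqrt{ac})^{2j}$, $Z\sqrt b+Y\sqrt c=(\sqrt b+\sqrt c)(t+\sqrt{bc})^{2k}$, $W\sqrt a+X\sqrt d=(\varepsilon\sqrt a+\sqrt d)(x+\sqrt{ad})^{2l}$, $W\sqrt b+Y\sqrt d=(\varepsilon\sqrt b+\sqrt d)(y+\sqrt{bd})^{2m}$ and $W\sqrt c+Z\sqrt d=(\varepsilon\sqrt c+\sqrt d)(z+\sqrt{cd})^{2n}$. Then $$l\equiv \tfrac{1-(-1)^j}{2}(-\varepsilon c)\pmod s,\quad n\equiv \tfrac{1-(-1)^j}{2}(\varepsilon a)\pmod s,$$ $$m\equiv \tfrac{1-(-1)^k}{2}(-\varepsilon c)\pmod t,\quad n\equiv \tfrac{1-(-1)^k}{2}(\varepsilon b)\pmod t.$$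
   Context: A Diophantine $m$-tuple is a set of $m$ distinct positive integers such that the product of any two of them increased by $1$ is a perfect square. An Euler triple is a Diophantine triple of the form $\{a,b,a+b+2\sqrt{ab+1}\}$. -}

module Defs where

open import Data.Nat as ℕ using (ℕ; zero; suc; _%_)
open import Data.Integer as ℤ using (ℤ; +_; _+_; _*_; _-_; -_)
open import Data.Integer.Divisibility using (_∣_)
open import Data.Product using (_×_; _,_; ∃-syntax)
open import Data.List using (List)
open import Data.List.Relation.Unary.All using (All)
open import Data.List.Relation.Unary.AllPairs using (AllPairs)
open import Data.List.Relation.Unary.Unique.Propositional using (Unique)
open import Relation.Binary.PropositionalEquality using (_≡_)

IsSquare : ℕ → Set
IsSquare n = ∃[ k ] k ℕ.* k ≡ n

DiophantineTuple : List ℕ → Set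
DiophantineTuple xs =
  Unique xs × All (ℕ._<_ 0) xs × AllPairs (λ p q → IsSquare (p ℕ.* q ℕ.+ 1)) xs

-- Formal elements  p √A + q √C  (p , q integers) and  u + v √(AC).
-- Since AC+1 is a square in our applications, AC is not a square, so √A and √C are
-- linearly independent over ℚ and such coefficient pairs represent real numbers faithfully.

-- (u + v√(AC)) (u' + v'√(AC))
quadMul : ℤ → ℤ → ℤ × ℤ → ℤ × ℤ → ℤ × ℤ
quadMul A C (u , v) (u' , v') = (u * u' + v * v' * A * C , u * v' + v * u')

quadPow : ℤ → ℤ → ℤ × ℤ → ℕ → ℤ × ℤ
quadPow A C w zero    = (+ 1 , + 0)
quadPow A C w (suc n) = quadMul A C (quadPow A C w n) w

-- (p√A + q√C)(u + v√(AC)) = (pu + qvC)√A + (qu + pvA)√C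
mixMul : ℤ → ℤ → ℤ × ℤ → ℤ × ℤ → ℤ × ℤ
mixMul A C (p , q) (u , v) = (p * u + q * v * C , q * u + p * v * A)

-- The real identity  P√A + Q√C = (p√A + q√C)(u + √(AC))^(2n),  A, C, u as naturals
PellEq : ℕ → ℕ → (P Q : ℤ) → (p q : ℤ) → (u : ℕ) → (n : ℕ) → Set
PellEq A C P Q p q u n =
  (P , Q) ≡ mixMul (+ A) (+ C) (p , q) (quadPow (+ A) (+ C) (+ u , + 1) (2 ℕ.* n))

-- (1 - (-1)^j) / 2
halfParity : ℕ → ℤ
halfParity j = + (j % 2)

_≡_[mod_] : ℤ → ℤ → ℤ → Set
x ≡ y [mod m ] = m ∣ (x - y)

-- Put s = a + r and t = b + r.  Then c = s + t, d = 4rst, x = 2rs - 1 and z = 2st + 1.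
-- Modulo 2s the square (s + √(ac))² = 2s² - 1 + 2s√(ac) is -1, while (x + √(ad))² is
-- 1 + 2x√(ad) with (2x√(ad))² = 4x²ad ≡ 0, and likewise for (z + √(cd))².  Comparing
-- coefficients in the Pell equations therefore gives X ≡ Z ≡ (-1)^j, X ≡ 1 + 2εaxl and
-- Z ≡ 1 + 2εczn (mod 2s); halving, εaxl ≡ εczn ≡ -[j odd] (mod s).  Since ac ≡ -1,
-- x ≡ -1 and z ≡ 1 (mod s), these solve for l and n.  Exchanging a and b gives the
-- congruences modulo t.

module Submission where

open import Defs

module _ where
  open import Data.Nat.Base using (ℕ; _+_; _*_)
  open import Data.Nat.Properties using (<-cmp; *-mono-<; <-irrefl; *-comm)
  open import Data.Nat.Divisibility using (_∣_; divides)
  open import Data.Nat.Tactic.RingSolver using (solve)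
  open import Data.Empty using (⊥-elim)
  open import Data.List.Base using (_∷_; [])
  open import Relation.Binary.Definitions using (tri<; tri≈; tri>)
  open import Relation.Binary.PropositionalEquality
    using (_≡_; sym; trans; cong; cong₂; module ≡-Reasoning)
  open ≡-Reasoning

  m*m≡n*n⇒m≡n : ∀ {m n} → m * m ≡ n * n → m ≡ n
  m*m≡n*n⇒m≡n {m} {n} m²≡n² with <-cmp m n
  ... | tri< m<n _ _ = ⊥-elim (<-irrefl m²≡n² (*-mono-< m<n m<n))
  ... | tri≈ _ m≡n _ = m≡n
  ... | tri> _ _ n<m = ⊥-elim (<-irrefl (sym m²≡n²) (*-mono-< n<m n<m))

  record EulerQuadruple (a b c d r : ℕ) : Set where
    field
      r²≡ab+1        : r * r ≡ a * b + 1
      c≡a+b+2r       : c ≡ a + b + 2 * r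
      d≡4r[a+r][b+r] : d ≡ 4 * r * (a + r) * (b + r)

  swap : ∀ {a b c d r} → EulerQuadruple a b c d r → EulerQuadruple b a c d r
  swap {a} {b} {c} {d} {r} E = record
    { r²≡ab+1        = trans r²≡ab+1 (cong (_+ 1) (*-comm a b))
    ; c≡a+b+2r       = trans c≡a+b+2r (solve (a ∷ b ∷ r ∷ []))
    ; d≡4r[a+r][b+r] = trans d≡4r[a+r][b+r] (solve (a ∷ b ∷ r ∷ []))
    }
    where open EulerQuadruple E

  module _ {a b c d r} (E : EulerQuadruple a b c d r) where
    open EulerQuadruple E

    a+r∣d : a + r ∣ d
    a+r∣d = divides (4 * r * (b + r)) (trans d≡4r[a+r][b+r] (solve (a ∷ b ∷ r ∷ [])))

    ac+1≡s²⇒s≡a+r : ∀ s → a * c + 1 ≡ s * s → s ≡ a + r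
    ac+1≡s²⇒s≡a+r s ac+1≡s² = m*m≡n*n⇒m≡n (begin
      s * s                            ≡⟨ ac+1≡s² ⟨
      a * c + 1                        ≡⟨ cong (λ c → a * c + 1) c≡a+b+2r ⟩
      a * (a + b + 2 * r) + 1          ≡⟨ solve (a ∷ b ∷ r ∷ []) ⟩
      a * a + 2 * a * r + (a * b + 1)  ≡⟨ cong (λ q → a * a + 2 * a * r + q) r²≡ab+1 ⟨
      a * a + 2 * a * r + r * r        ≡⟨ solve (a ∷ r ∷ []) ⟩
      (a + r) * (a + r)                ∎)

    ad+1≡x²⇒a+r∣1+x : ∀ x → a * d + 1 ≡ x * x → a + r ∣ 1 + x
    ad+1≡x²⇒a+r∣1+x x ad+1≡x² = divides (2 * r) (begin
      1 + x                            ≡⟨ cong (1 +_) x≡2a[b+r]+1 ⟩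
      1 + (2 * a * (b + r) + 1)        ≡⟨ solve (a ∷ b ∷ r ∷ []) ⟩
      2 * (a * r + (a * b + 1))        ≡⟨ cong (λ q → 2 * (a * r + q)) r²≡ab+1 ⟨
      2 * (a * r + r * r)              ≡⟨ solve (a ∷ r ∷ []) ⟩
      2 * r * (a + r)                  ∎)
      where
      x≡2a[b+r]+1 : x ≡ 2 * a * (b + r) + 1
      x≡2a[b+r]+1 = m*m≡n*n⇒m≡n (begin
        x * x                                          ≡⟨ ad+1≡x² ⟨
        a * d + 1                                      ≡⟨ cong (λ d → a * d + 1) d≡4r[a+r][b+r] ⟩
        a * (4 * r * (a + r) * (b + r)) + 1            ≡⟨ solve (a ∷ b ∷ r ∷ []) ⟩
        4 * (a * (b + r)) * (a * r + r * r) + 1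
          ≡⟨ cong (λ q → 4 * (a * (b + r)) * (a * r + q) + 1) r²≡ab+1 ⟩
        4 * (a * (b + r)) * (a * r + (a * b + 1)) + 1  ≡⟨ solve (a ∷ b ∷ r ∷ []) ⟩
        (2 * a * (b + r) + 1) * (2 * a * (b + r) + 1)  ∎)

    cd+1≡z²⇒z≡1+2[b+r][a+r] : ∀ z → c * d + 1 ≡ z * z → z ≡ 1 + 2 * (b + r) * (a + r)
    cd+1≡z²⇒z≡1+2[b+r][a+r] z cd+1≡z² = m*m≡n*n⇒m≡n (begin
      z * z                                            ≡⟨ cd+1≡z² ⟨
      c * d + 1
        ≡⟨ cong₂ (λ c d → c * d + 1) c≡a+b+2r d≡4r[a+r][b+r] ⟩
      (a + b + 2 * r) * (4 * r * (a + r) * (b + r)) + 1 ≡⟨ solve (a ∷ b ∷ r ∷ []) ⟩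
      4 * (a + r) * (b + r) * (a * r + b * r + r * r + r * r) + 1
        ≡⟨ cong (λ q → 4 * (a + r) * (b + r) * (a * r + b * r + r * r + q) + 1) r²≡ab+1 ⟩
      4 * (a + r) * (b + r) * (a * r + b * r + r * r + (a * b + 1)) + 1
        ≡⟨ solve (a ∷ b ∷ r ∷ []) ⟩
      (1 + 2 * (b + r) * (a + r)) * (1 + 2 * (b + r) * (a + r)) ∎)

module _ where
  open import Data.Nat.Base as ℕ using (ℕ; zero; suc)
  open import Data.Nat.Properties using (*-suc)
  open import Data.Nat.DivMod using (%-remove-+ˡ)
  open import Data.Nat.Divisibility using (_∣_; divides; ∣-refl)
  open import Data.Integer.Base using (ℤ; +_; -_; _+_; _-_; _*_; _^_; 0ℤ; 1ℤ; -1ℤ; NonZero)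
  open import Data.Integer.Properties using (*-cancelˡ-≡; pos-+; pos-*)
  import Data.Integer.Divisibility.Signed as Signed
  open import Data.Integer.Tactic.RingSolver using (solve)
  open import Data.List.Base using (_∷_; [])
  open import Data.Product.Base using (_×_; _,_; proj₁; proj₂)
  open import Data.Sum.Base using (_⊎_; inj₁; inj₂)
  open import Relation.Binary.Bundles using (Setoid)
  open import Relation.Binary.PropositionalEquality
    using (_≡_; refl; cong; cong₂; module ≡-Reasoning)
  import Relation.Binary.Reasoning.Setoid as SetoidReasoning

  infix 4 _≈_[mod_]

  -- Defs' _≡_[mod_] compares absolute values, which hides x and y from unification; this
  -- equivalent form is used for all the reasoning and converted back by ≈⇒≡[mod].
  record _≈_[mod_] (x y m : ℤ) : Set where
    constructor congruent
    field
      quotient : ℤ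
      equation : x ≡ y + quotient * m

  module _ {m : ℤ} where

    ≈-reflexive : ∀ {x y} → x ≡ y → x ≈ y [mod m ]
    ≈-reflexive {x} refl = congruent 0ℤ (solve (x ∷ m ∷ []))

    ≈-refl : ∀ {x} → x ≈ x [mod m ]
    ≈-refl = ≈-reflexive refl

    ≈-sym : ∀ {x y} → x ≈ y [mod m ] → y ≈ x [mod m ]
    ≈-sym {y = y} (congruent k refl) = congruent (- k) (solve (y ∷ k ∷ m ∷ []))

    ≈-trans : ∀ {x y z} → x ≈ y [mod m ] → y ≈ z [mod m ] → x ≈ z [mod m ]
    ≈-trans {z = z} (congruent k refl) (congruent k′ refl) =
      congruent (k′ + k) (solve (z ∷ k ∷ k′ ∷ m ∷ []))

    +-cong : ∀ {x y u v} → x ≈ y [mod m ] → u ≈ v [mod m ] → x + u ≈ y + v [mod m ]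
    +-cong {y = y} {v = v} (congruent k refl) (congruent k′ refl) =
      congruent (k + k′) (solve (y ∷ v ∷ k ∷ k′ ∷ m ∷ []))

    *-cong : ∀ {x y u v} → x ≈ y [mod m ] → u ≈ v [mod m ] → x * u ≈ y * v [mod m ]
    *-cong {y = y} {v = v} (congruent k refl) (congruent k′ refl) =
      congruent (k * v + y * k′ + k * k′ * m) (solve (y ∷ v ∷ k ∷ k′ ∷ m ∷ []))

    *-congˡ : ∀ k {x y} → x ≈ y [mod m ] → k * x ≈ k * y [mod m ]
    *-congˡ k = *-cong (≈-refl {k})

    *-congʳ : ∀ k {x y} → x ≈ y [mod m ] → x * k ≈ y * k [mod m ]
    *-congʳ k x≈y = *-cong x≈y (≈-refl {k})

    +-congˡ : ∀ k {x y} → x ≈ y [mod m ] → k + x ≈ k + y [mod m ]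
    +-congˡ k = +-cong (≈-refl {k})

    +-congʳ : ∀ k {x y} → x ≈ y [mod m ] → x + k ≈ y + k [mod m ]
    +-congʳ k x≈y = +-cong x≈y (≈-refl {k})

    -‿cong : ∀ {x y} → x ≈ y [mod m ] → - x ≈ - y [mod m ]
    -‿cong {y = y} (congruent k refl) = congruent (- k) (solve (y ∷ k ∷ m ∷ []))

    +-cancelˡ : ∀ z {x y} → z + x ≈ z + y [mod m ] → x ≈ y [mod m ]
    +-cancelˡ z {x} {y} (congruent k eq) = congruent k (begin
      x                      ≡⟨ solve (z ∷ x ∷ []) ⟩
      - z + (z + x)          ≡⟨ cong (λ w → - z + w) eq ⟩
      - z + (z + y + k * m)  ≡⟨ solve (z ∷ y ∷ k ∷ m ∷ []) ⟩
      y + k * m              ∎)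
      where open ≡-Reasoning

    ≈-setoid : Setoid _ _
    ≈-setoid = record
      { Carrier       = ℤ
      ; _≈_           = _≈_[mod m ]
      ; isEquivalence = record { refl = ≈-refl ; sym = ≈-sym ; trans = ≈-trans }
      }

  module ≈-Reasoning (m : ℤ) = SetoidReasoning (≈-setoid {m})

  *-cancelˡ : ∀ k {m x y} .{{_ : NonZero k}} → k * x ≈ k * y [mod k * m ] → x ≈ y [mod m ]
  *-cancelˡ k {m} {x} {y} (congruent q eq) = congruent q (*-cancelˡ-≡ k x (y + q * m) (begin
    k * x                  ≡⟨ eq ⟩
    k * y + q * (k * m)    ≡⟨ solve (k ∷ y ∷ q ∷ m ∷ []) ⟩
    k * (y + q * m)        ∎))
    where open ≡-Reasoning

  ≈⇒≡[mod] : ∀ {x y m} → x ≈ y [mod m ] → x ≡ y [mod m ]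
  ≈⇒≡[mod] {x} {y} {m} (congruent k eq) =
    Signed.∣⇒∣ᵤ {m} {x - y} (Signed.divides k (begin
    x - y              ≡⟨ cong (_- y) eq ⟩
    y + k * m - y      ≡⟨ solve (y ∷ k ∷ m ∷ []) ⟩
    k * m              ∎))
    where open ≡-Reasoning

  pos-*-+1 : ∀ A C S → A ℕ.* C ℕ.+ 1 ≡ S ℕ.* S → + A * + C + 1ℤ ≡ + S * + S
  pos-*-+1 A C S AC+1≡S² = begin
    + A * + C + 1ℤ        ≡⟨ cong (_+ 1ℤ) (pos-* A C) ⟨
    + (A ℕ.* C) + 1ℤ      ≡⟨ pos-+ (A ℕ.* C) 1 ⟨
    + (A ℕ.* C ℕ.+ 1)     ≡⟨ cong +_ AC+1≡S² ⟩
    + (S ℕ.* S)           ≡⟨ pos-* S S ⟩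
    + S * + S             ∎
    where open ≡-Reasoning

  pos-≈ : ∀ {x y} q m → x ≡ y ℕ.+ q ℕ.* m → + x ≈ + y [mod + m ]
  pos-≈ {x} {y} q m x≡y+qm = congruent (+ q) (begin
    + x                  ≡⟨ cong +_ x≡y+qm ⟩
    + (y ℕ.+ q ℕ.* m)    ≡⟨ pos-+ y (q ℕ.* m) ⟩
    + y + + (q ℕ.* m)    ≡⟨ cong (λ w → + y + w) (pos-* q m) ⟩
    + y + + q * + m      ∎)
    where open ≡-Reasoning

  ∣⇒≈0 : ∀ {m n} → m ∣ n → + n ≈ 0ℤ [mod + m ]
  ∣⇒≈0 {m} (divides q n≡qm) = pos-≈ q m n≡qm

  ∣1+⇒≈-1 : ∀ {m x} → m ∣ 1 ℕ.+ x → + x ≈ -1ℤ [mod + m ]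
  ∣1+⇒≈-1 {m} {x} m∣1+x = begin
    + x                ≡⟨ add-sub (+ x) ⟩
    1ℤ + + x + -1ℤ     ≈⟨ +-congʳ -1ℤ (∣⇒≈0 m∣1+x) ⟩
    0ℤ + -1ℤ           ≡⟨⟩
    -1ℤ                ∎
    where
    open ≈-Reasoning (+ m)
    add-sub : ∀ y → y ≡ 1ℤ + y + -1ℤ
    add-sub y = solve (y ∷ [])

  infix 4 _≋_[mod_]

  record _≋_[mod_] (w w′ : ℤ × ℤ) (m : ℤ) : Set where
    constructor _,_
    field
      proj₁-≈ : proj₁ w ≈ proj₁ w′ [mod m ]
      proj₂-≈ : proj₂ w ≈ proj₂ w′ [mod m ]

  open _≋_[mod_] public

  module _ {m : ℤ} where

    ≋-reflexive : ∀ {w w′} → w ≡ w′ → w ≋ w′ [mod m ]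
    ≋-reflexive refl = ≈-refl , ≈-refl

    ≋-trans : ∀ {w w′ w″} → w ≋ w′ [mod m ] → w′ ≋ w″ [mod m ] → w ≋ w″ [mod m ]
    ≋-trans (u , v) (u′ , v′) = ≈-trans u u′ , ≈-trans v v′

    quadMul-cong : ∀ A C {w₁ w₁′ w₂ w₂′} → w₁ ≋ w₁′ [mod m ] → w₂ ≋ w₂′ [mod m ] →
                   quadMul A C w₁ w₂ ≋ quadMul A C w₁′ w₂′ [mod m ]
    quadMul-cong A C (u₁ , v₁) (u₂ , v₂) =
      +-cong (*-cong u₁ u₂) (*-congʳ C (*-congʳ A (*-cong v₁ v₂))) ,
      +-cong (*-cong u₁ v₂) (*-cong v₁ u₂)

    quadPow-cong : ∀ A C {w w′} n → w ≋ w′ [mod m ] → quadPow A C w n ≋ quadPow A C w′ n [mod m ]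
    quadPow-cong A C zero    _    = ≈-refl , ≈-refl
    quadPow-cong A C (suc n) w≋w′ = quadMul-cong A C (quadPow-cong A C n w≋w′) w≋w′

    mixMul-congʳ : ∀ A C p {w w′} → w ≋ w′ [mod m ] → mixMul A C p w ≋ mixMul A C p w′ [mod m ]
    mixMul-congʳ A C (p , q) (u , v) =
      +-cong (*-congˡ p u) (*-congʳ C (*-congˡ q v)) ,
      +-cong (*-congˡ q u) (*-congʳ A (*-congˡ p v))

  quadMul-assoc : ∀ A C w₁ w₂ w₃ →
                  quadMul A C (quadMul A C w₁ w₂) w₃ ≡ quadMul A C w₁ (quadMul A C w₂ w₃)
  quadMul-assoc A C (u₁ , v₁) (u₂ , v₂) (u₃ , v₃) = cong₂ _,_ rational irrational
    where
    rational : (u₁ * u₂ + v₁ * v₂ * A * C) * u₃ + (u₁ * v₂ + v₁ * u₂) * v₃ * A * C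
             ≡ u₁ * (u₂ * u₃ + v₂ * v₃ * A * C) + v₁ * (u₂ * v₃ + v₂ * u₃) * A * C
    rational = solve (A ∷ C ∷ u₁ ∷ v₁ ∷ u₂ ∷ v₂ ∷ u₃ ∷ v₃ ∷ [])
    irrational : (u₁ * u₂ + v₁ * v₂ * A * C) * v₃ + (u₁ * v₂ + v₁ * u₂) * u₃
               ≡ u₁ * (u₂ * v₃ + v₂ * u₃) + v₁ * (u₂ * u₃ + v₂ * v₃ * A * C)
    irrational = solve (A ∷ C ∷ u₁ ∷ v₁ ∷ u₂ ∷ v₂ ∷ u₃ ∷ v₃ ∷ [])

  quadPow-2* : ∀ A C w n → quadPow A C w (2 ℕ.* n) ≡ quadPow A C (quadMul A C w w) n
  quadPow-2* A C w zero    = refl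
  quadPow-2* A C w (suc n) = begin
    quadPow A C w (2 ℕ.* suc n)                              ≡⟨ cong (quadPow A C w) (*-suc 2 n) ⟩
    quadMul A C (quadMul A C (quadPow A C w (2 ℕ.* n)) w) w
      ≡⟨ quadMul-assoc A C (quadPow A C w (2 ℕ.* n)) w w ⟩
    quadMul A C (quadPow A C w (2 ℕ.* n)) (quadMul A C w w)
      ≡⟨ cong (λ p → quadMul A C p (quadMul A C w w)) (quadPow-2* A C w n) ⟩
    quadPow A C (quadMul A C w w) (suc n)                    ∎
    where open ≡-Reasoning

  quadPow-[-1,0] : ∀ A C n → quadPow A C (-1ℤ , 0ℤ) n ≡ (-1ℤ ^ n , 0ℤ)
  quadPow-[-1,0] A C zero    = refl
  quadPow-[-1,0] A C (suc n) rewrite quadPow-[-1,0] A C n =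
    cong₂ _,_ (rational (-1ℤ ^ n)) (irrational (-1ℤ ^ n))
    where
    rational : ∀ σ → σ * -1ℤ + 0ℤ * 0ℤ * A * C ≡ -1ℤ * σ
    rational σ = solve (σ ∷ A ∷ C ∷ [])
    irrational : ∀ σ → σ * 0ℤ + 0ℤ * -1ℤ ≡ 0ℤ
    irrational σ = solve (σ ∷ [])

  quadPow-[1,β] : ∀ A C β {m} n → β * β * A * C ≈ 0ℤ [mod m ] →
                  quadPow A C (1ℤ , β) n ≋ (1ℤ , + n * β) [mod m ]
  quadPow-[1,β] A C β zero    _   = ≋-reflexive (cong (1ℤ ,_) (solve (β ∷ [])))
  quadPow-[1,β] A C β {m} (suc n) nil =
    ≋-trans (quadMul-cong A C (quadPow-[1,β] A C β n nil) (≋-reflexive refl))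
            (rational , ≈-reflexive (irrational (+ n)))
    where
    open ≈-Reasoning m
    rational : 1ℤ * 1ℤ + + n * β * β * A * C ≈ 1ℤ [mod m ]
    rational = begin
      1ℤ * 1ℤ + + n * β * β * A * C  ≡⟨ factor (+ n) ⟩
      1ℤ + + n * (β * β * A * C)     ≈⟨ +-congˡ 1ℤ (*-congˡ (+ n) nil) ⟩
      1ℤ + + n * 0ℤ                  ≡⟨ annihilate (+ n) ⟩
      1ℤ                             ∎
      where
      factor : ∀ N → 1ℤ * 1ℤ + N * β * β * A * C ≡ 1ℤ + N * (β * β * A * C)
      factor N = solve (N ∷ β ∷ A ∷ C ∷ [])
      annihilate : ∀ N → 1ℤ + N * 0ℤ ≡ 1ℤ
      annihilate N = solve (N ∷ [])
    irrational : ∀ N → 1ℤ * β + N * β * 1ℤ ≡ (1ℤ + N) * β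
    irrational N = solve (N ∷ β ∷ [])

  quadPow-2n≋[-1^n,0] : ∀ A C S n → A * C + 1ℤ ≡ S * S →
                        quadPow A C (S , 1ℤ) (2 ℕ.* n) ≋ (-1ℤ ^ n , 0ℤ) [mod + 2 * S ]
  quadPow-2n≋[-1^n,0] A C S n AC+1≡S² =
    ≋-trans (≋-reflexive (quadPow-2* A C (S , 1ℤ) n))
      (≋-trans (quadPow-cong A C n square≋[-1,0]) (≋-reflexive (quadPow-[-1,0] A C n)))
    where
    square≋[-1,0] : quadMul A C (S , 1ℤ) (S , 1ℤ) ≋ (-1ℤ , 0ℤ) [mod + 2 * S ]
    square≋[-1,0] = congruent S (begin
      S * S + 1ℤ * 1ℤ * A * C     ≡⟨ solve (S ∷ A ∷ C ∷ []) ⟩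
      S * S + (A * C + 1ℤ) - 1ℤ   ≡⟨ cong (λ q → S * S + q - 1ℤ) AC+1≡S² ⟩
      S * S + S * S - 1ℤ          ≡⟨ solve (S ∷ []) ⟩
      -1ℤ + S * (+ 2 * S)         ∎)
      , congruent 1ℤ irrational
      where
      open ≡-Reasoning
      irrational : S * 1ℤ + 1ℤ * S ≡ 0ℤ + 1ℤ * (+ 2 * S)
      irrational = solve (S ∷ [])

  quadPow-2n≋[1,2nx] : ∀ A D S x n → D ≈ 0ℤ [mod S ] → A * D + 1ℤ ≡ x * x →
                       quadPow A D (x , 1ℤ) (2 ℕ.* n) ≋ (1ℤ , + n * (+ 2 * x)) [mod + 2 * S ]
  quadPow-2n≋[1,2nx] A D S x n (congruent q refl) AD+1≡x² =
    ≋-trans (≋-reflexive (quadPow-2* A D (x , 1ℤ) n))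
      (≋-trans (quadPow-cong A D n square≋[1,2x]) (quadPow-[1,β] A D (+ 2 * x) n nilpotent))
    where
    square≋[1,2x] : quadMul A D (x , 1ℤ) (x , 1ℤ) ≋ (1ℤ , + 2 * x) [mod + 2 * S ]
    square≋[1,2x] = congruent (A * q) (begin
      x * x + 1ℤ * 1ℤ * A * D     ≡⟨ cong (λ y → y + 1ℤ * 1ℤ * A * D) AD+1≡x² ⟨
      A * D + 1ℤ + 1ℤ * 1ℤ * A * D  ≡⟨ solve (A ∷ q ∷ S ∷ []) ⟩
      1ℤ + A * q * (+ 2 * S)      ∎)
      , ≈-reflexive irrational
      where
      open ≡-Reasoning
      irrational : x * 1ℤ + 1ℤ * x ≡ + 2 * x
      irrational = solve (x ∷ [])
    nilpotent : + 2 * x * (+ 2 * x) * A * D ≈ 0ℤ [mod + 2 * S ]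
    nilpotent = congruent (+ 2 * x * x * A * q) (solve (x ∷ A ∷ q ∷ S ∷ []))

  pellEq⇒≋[-1^n,-1^n] : ∀ A C S n {P Q} → A ℕ.* C ℕ.+ 1 ≡ S ℕ.* S →
                        PellEq A C P Q 1ℤ 1ℤ S n → (P , Q) ≋ (-1ℤ ^ n , -1ℤ ^ n) [mod + 2 * + S ]
  pellEq⇒≋[-1^n,-1^n] A C S n AC+1≡S² refl =
    ≋-trans (mixMul-congʳ (+ A) (+ C) (1ℤ , 1ℤ)
              (quadPow-2n≋[-1^n,0] (+ A) (+ C) (+ S) n (pos-*-+1 A C S AC+1≡S²)))
            (≋-reflexive (cong₂ _,_ (collapse (-1ℤ ^ n) (+ C)) (collapse (-1ℤ ^ n) (+ A))))
    where
    collapse : ∀ σ B → 1ℤ * σ + 1ℤ * 0ℤ * B ≡ σ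
    collapse σ B = solve (σ ∷ B ∷ [])

  pellEq⇒≈1+2εAxn : ∀ A D S x n ε {P Q} → + D ≈ 0ℤ [mod + S ] → A ℕ.* D ℕ.+ 1 ≡ x ℕ.* x →
                    PellEq A D P Q ε 1ℤ x n → Q ≈ 1ℤ + + 2 * (ε * + A * + x * + n) [mod + 2 * + S ]
  pellEq⇒≈1+2εAxn A D S x n ε D≈0 AD+1≡x² refl =
    ≈-trans (proj₂-≈ (mixMul-congʳ (+ A) (+ D) (ε , 1ℤ)
              (quadPow-2n≋[1,2nx] (+ A) (+ D) (+ S) (+ x) n D≈0 (pos-*-+1 A D x AD+1≡x²))))
            (≈-reflexive (rearrange (+ A) (+ x) (+ n)))
    where
    rearrange : ∀ A x N → 1ℤ * 1ℤ + ε * (N * (+ 2 * x)) * A ≡ 1ℤ + + 2 * (ε * A * x * N)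
    rearrange A x N = solve (ε ∷ A ∷ x ∷ N ∷ [])

  -1^n≡1-2*halfParity : ∀ n → -1ℤ ^ n ≡ 1ℤ - + 2 * halfParity n
  -1^n≡1-2*halfParity 0             = refl
  -1^n≡1-2*halfParity 1             = refl
  -1^n≡1-2*halfParity (suc (suc n)) = begin
    -1ℤ * (-1ℤ * -1ℤ ^ n)                  ≡⟨ square-sign (-1ℤ ^ n) ⟩
    -1ℤ ^ n                                ≡⟨ -1^n≡1-2*halfParity n ⟩
    1ℤ - + 2 * halfParity n
      ≡⟨ cong (λ h → 1ℤ - + 2 * + h) (%-remove-+ˡ {2} n {2} ∣-refl) ⟨
    1ℤ - + 2 * halfParity (suc (suc n))    ∎
    where
    open ≡-Reasoning
    square-sign : ∀ σ → -1ℤ * (-1ℤ * σ) ≡ σ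
    square-sign σ = solve (σ ∷ [])

  -1^n≈1+2u⇒u≈-halfParity : ∀ n S u → -1ℤ ^ n ≈ 1ℤ + + 2 * u [mod + 2 * S ] →
                            u ≈ - halfParity n [mod S ]
  -1^n≈1+2u⇒u≈-halfParity n S u -1^n≈1+2u =
    ≈-sym (*-cancelˡ (+ 2) (+-cancelˡ 1ℤ (begin
      1ℤ + + 2 * - halfParity n   ≡⟨ neg-inside (halfParity n) ⟨
      1ℤ - + 2 * halfParity n     ≡⟨ -1^n≡1-2*halfParity n ⟨
      -1ℤ ^ n                     ≈⟨ -1^n≈1+2u ⟩
      1ℤ + + 2 * u                ∎)))
    where
    open ≈-Reasoning (+ 2 * S)
    neg-inside : ∀ h → 1ℤ - + 2 * h ≡ 1ℤ + + 2 * - h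
    neg-inside h = solve (h ∷ [])

  ε*ε≡1 : ∀ {ε} → ε ≡ 1ℤ ⊎ ε ≡ -1ℤ → ε * ε ≡ 1ℤ
  ε*ε≡1 (inj₁ refl) = refl
  ε*ε≡1 (inj₂ refl) = refl

  module _ (a c s ε : ℤ) where

    εa*εc≈-1 : a * c + 1ℤ ≡ s * s → ε * ε ≡ 1ℤ → (ε * a) * (ε * c) ≈ -1ℤ [mod s ]
    εa*εc≈-1 ac+1≡s² ε²≡1 = congruent s (begin
      (ε * a) * (ε * c)                ≡⟨ solve (ε ∷ a ∷ c ∷ []) ⟩
      (ε * ε) * (a * c + 1ℤ) - ε * ε   ≡⟨ cong₂ (λ e q → e * q - e) ε²≡1 ac+1≡s² ⟩
      1ℤ * (s * s) - 1ℤ                ≡⟨ solve (s ∷ []) ⟩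
      -1ℤ + s * s                      ∎)
      where open ≡-Reasoning

    εaxl≈-h⇒l≈h*-εc : ∀ {x} h l → (ε * a) * (ε * c) ≈ -1ℤ [mod s ] → x ≈ -1ℤ [mod s ] →
                      ε * a * x * l ≈ - h [mod s ] → l ≈ h * - (ε * c) [mod s ]
    εaxl≈-h⇒l≈h*-εc {x} h l εaεc≈-1 x≈-1 εaxl≈-h = begin
      l                       ≡⟨ solve (l ∷ []) ⟩
      - -1ℤ * l               ≈⟨ *-congʳ l (-‿cong εaεc≈-1) ⟨
      - (ε * a * (ε * c)) * l ≡⟨ solve (ε ∷ a ∷ c ∷ l ∷ []) ⟩
      ε * a * l * - (ε * c)   ≈⟨ *-congʳ (- (ε * c)) εal≈h ⟩
      h * - (ε * c)           ∎
      where
      open ≈-Reasoning s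
      εal≈h : ε * a * l ≈ h [mod s ]
      εal≈h = begin
        ε * a * l               ≡⟨ solve (ε ∷ a ∷ l ∷ []) ⟩
        - (ε * a * -1ℤ * l)     ≈⟨ -‿cong (*-congʳ l (*-congˡ (ε * a) x≈-1)) ⟨
        - (ε * a * x * l)       ≈⟨ -‿cong εaxl≈-h ⟩
        - - h                   ≡⟨ solve (h ∷ []) ⟩
        h                       ∎

    εczn≈-h⇒n≈h*εa : ∀ {z} h n → (ε * a) * (ε * c) ≈ -1ℤ [mod s ] → z ≈ 1ℤ [mod s ] →
                     ε * c * z * n ≈ - h [mod s ] → n ≈ h * (ε * a) [mod s ]
    εczn≈-h⇒n≈h*εa {z} h n εaεc≈-1 z≈1 εczn≈-h = begin
      n                       ≡⟨ solve (n ∷ []) ⟩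
      - -1ℤ * n               ≈⟨ *-congʳ n (-‿cong εaεc≈-1) ⟨
      - (ε * a * (ε * c)) * n ≡⟨ solve (ε ∷ a ∷ c ∷ n ∷ []) ⟩
      - (ε * c * n) * (ε * a) ≈⟨ *-congʳ (ε * a) (-‿cong εcn≈-h) ⟩
      - - h * (ε * a)         ≡⟨ solve (h ∷ ε ∷ a ∷ []) ⟩
      h * (ε * a)             ∎
      where
      open ≈-Reasoning s
      εcn≈-h : ε * c * n ≈ - h [mod s ]
      εcn≈-h = begin
        ε * c * n               ≡⟨ solve (ε ∷ c ∷ n ∷ []) ⟩
        ε * c * 1ℤ * n          ≈⟨ *-congʳ n (*-congˡ (ε * c) z≈1) ⟨
        ε * c * z * n           ≈⟨ εczn≈-h ⟩
        - h                     ∎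

  congruences-mod-s : ∀ {a b c d r} → EulerQuadruple a b c d r → ∀ s x z ε j l n {P Q R} →
    a ℕ.* c ℕ.+ 1 ≡ s ℕ.* s → a ℕ.* d ℕ.+ 1 ≡ x ℕ.* x → c ℕ.* d ℕ.+ 1 ≡ z ℕ.* z →
    ε * ε ≡ 1ℤ →
    PellEq a c R Q 1ℤ 1ℤ s j → PellEq a d P Q ε 1ℤ x l → PellEq c d P R ε 1ℤ z n →
    ((+ l) ≡ halfParity j * - (ε * + c) [mod + s ]) ×
    ((+ n) ≡ halfParity j * (ε * + a) [mod + s ])
  congruences-mod-s {a} {b} {c} {d} {r} E s x z ε j l n {P} {Q} {R}
                    ac+1≡s² ad+1≡x² cd+1≡z² ε²≡1 pell-ac pell-ad pell-cd
    with ac+1≡s²⇒s≡a+r E s ac+1≡s²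
  ... | refl =
    ≈⇒≡[mod] (εaxl≈-h⇒l≈h*-εc A C S ε h (+ l) εaεc≈-1 x≈-1 εaxl≈-h) ,
    ≈⇒≡[mod] (εczn≈-h⇒n≈h*εa A C S ε h (+ n) εaεc≈-1 z≈1 εczn≈-h)
    where
    A = + a
    C = + c
    S = + s
    h = halfParity j

    εaεc≈-1 : (ε * A) * (ε * C) ≈ -1ℤ [mod S ]
    εaεc≈-1 = εa*εc≈-1 A C S ε (pos-*-+1 a c s ac+1≡s²) ε²≡1

    d≈0 : + d ≈ 0ℤ [mod S ]
    d≈0 = ∣⇒≈0 (a+r∣d E)

    x≈-1 : + x ≈ -1ℤ [mod S ]
    x≈-1 = ∣1+⇒≈-1 (ad+1≡x²⇒a+r∣1+x E x ad+1≡x²)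

    z≈1 : + z ≈ 1ℤ [mod S ]
    z≈1 = pos-≈ (2 ℕ.* (b ℕ.+ r)) s (cd+1≡z²⇒z≡1+2[b+r][a+r] E z cd+1≡z²)

    ZX≋-1^j : (R , Q) ≋ (-1ℤ ^ j , -1ℤ ^ j) [mod + 2 * S ]
    ZX≋-1^j = pellEq⇒≋[-1^n,-1^n] a c s j ac+1≡s² pell-ac

    εaxl≈-h : ε * A * + x * + l ≈ - h [mod S ]
    εaxl≈-h = -1^n≈1+2u⇒u≈-halfParity j S (ε * A * + x * + l)
      (≈-trans (≈-sym (proj₂-≈ ZX≋-1^j)) (pellEq⇒≈1+2εAxn a d s x l ε d≈0 ad+1≡x² pell-ad))

    εczn≈-h : ε * C * + z * + n ≈ - h [mod S ]
    εczn≈-h = -1^n≈1+2u⇒u≈-halfParity j S (ε * C * + z * + n)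
      (≈-trans (≈-sym (proj₁-≈ ZX≋-1^j)) (pellEq⇒≈1+2εAxn c d s z n ε d≈0 cd+1≡z² pell-cd))

open import Data.Nat using (ℕ; _<_; _+_; _*_)
open import Data.Integer using (ℤ; +_; -_)
open import Data.Product using (_×_; _,_; proj₁; proj₂)
open import Data.Sum using (_⊎_)
open import Data.List using (_∷_; [])
open import Relation.Binary.PropositionalEquality using (_≡_)

lemma8p1 : (a b c d e r : ℕ) → a < b → b < c → c < d → d < e →
    DiophantineTuple (a ∷ b ∷ c ∷ d ∷ e ∷ []) →
    r * r ≡ a * b + 1 → c ≡ a + b + 2 * r → d ≡ 4 * r * (a + r) * (b + r) →
    (s t x y z X Y Z W : ℕ) →
    a * c + 1 ≡ s * s → b * c + 1 ≡ t * t → a * d + 1 ≡ x * x → b * d + 1 ≡ y * y →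
    c * d + 1 ≡ z * z → a * e + 1 ≡ X * X → b * e + 1 ≡ Y * Y → c * e + 1 ≡ Z * Z →
    d * e + 1 ≡ W * W →
    (ε : ℤ) → ε ≡ + 1 ⊎ ε ≡ - (+ 1) →
    (j k l m n : ℕ) →
    PellEq a c (+ Z) (+ X) (+ 1) (+ 1) s j →
    PellEq b c (+ Z) (+ Y) (+ 1) (+ 1) t k →
    PellEq a d (+ W) (+ X) ε (+ 1) x l →
    PellEq b d (+ W) (+ Y) ε (+ 1) y m →
    PellEq c d (+ W) (+ Z) ε (+ 1) z n →
    ((+ l) ≡ halfParity j Data.Integer.* (- (ε Data.Integer.* + c)) [mod + s ]) ×
    ((+ n) ≡ halfParity j Data.Integer.* (ε Data.Integer.* + a) [mod + s ]) ×
    ((+ m) ≡ halfParity k Data.Integer.* (- (ε Data.Integer.* + c)) [mod + t ]) ×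
    ((+ n) ≡ halfParity k Data.Integer.* (ε Data.Integer.* + b) [mod + t ])
lemma8p1 a b c d e r _ _ _ _ _ r²≡ab+1 c≡a+b+2r d≡4r[a+r][b+r] s t x y z X Y Z W
         ac+1≡s² bc+1≡t² ad+1≡x² bd+1≡y² cd+1≡z² _ _ _ _ ε ε≡±1 j k l m n
         pell-ac pell-bc pell-ad pell-bd pell-cd =
  proj₁ mod-s , proj₂ mod-s , mod-t
  where
  E : EulerQuadruple a b c d r
  E = record { r²≡ab+1 = r²≡ab+1 ; c≡a+b+2r = c≡a+b+2r ; d≡4r[a+r][b+r] = d≡4r[a+r][b+r] }
  ε²≡1 = ε*ε≡1 ε≡±1
  mod-s = congruences-mod-s E s x z ε j l n
            ac+1≡s² ad+1≡x² cd+1≡z² ε²≡1 pell-ac pell-ad pell-cd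
  mod-t = congruences-mod-s (swap E) t y z ε k m n
            bc+1≡t² bd+1≡y² cd+1≡z² ε²≡1 pell-bc pell-bd pell-cd
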